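{- Let $P$ be a poset, $W$ a topological space that admits a good $P$-partition $\{X_p\mid p\in P\}$, and $A$ a compact closed subset of $W$. Then every descending chain $p_1\ge p_2\ge\cdots$ of elements of $T(A)$ has a lower bound in $P$.
   Context: For a poset $(P,\le)$ and topological space $W$, a good $P$-partition of $W$ is a family $\{X_p\mid p\in P\}$ of pairwise disjoint non-empty subsets of $W$ with union $W$ such that $\overline{X_p}=\bigcup_{q\le p}X_q$ for all $p\in P$. For $Y\subseteq W$, $T(Y)=\{p\in P: Y\cap X_p\neq\emptyset\}$. -}

module Defs where

open import Level using (0ℓ)
open import Data.Empty using (⊥)
open import Data.Nat using (ℕ; suc)
open import Data.Product using (Σ; ∃; _×_; _,_)
open import Data.List using (List)
open import Data.List.Relation.Unary.Any using (Any)
open import Relation.Nullary using (¬_)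
open import Relation.Unary using (Pred; _∈_; _⊆_; ∁)
open import Relation.Binary.Core using (Rel)
open import Relation.Binary.Structures using (IsPartialOrder)
open import Relation.Binary.PropositionalEquality using (_≡_)

-- A topology on W, presented predicatively: a (small) type of codes O for
-- open sets, with interpretation ⟦_⟧, closed under finite intersections
-- (incl. the whole space) and arbitrary unions indexed by small types.
-- "U is open" means U is extensionally equal to ⟦ o ⟧ for some code o.
record Topology (W : Set) : Set₁ where
  field
    O    : Set
    ⟦_⟧  : O → Pred W 0ℓ
    univ : ∃ λ o → ∀ x → x ∈ ⟦ o ⟧
    inter : ∀ o₁ o₂ → ∃ λ o → ∀ x → (x ∈ ⟦ o ⟧ → x ∈ ⟦ o₁ ⟧ × x ∈ ⟦ o₂ ⟧)
                                    × (x ∈ ⟦ o₁ ⟧ × x ∈ ⟦ o₂ ⟧ → x ∈ ⟦ o ⟧)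
    union : ∀ (I : Set) (f : I → O) → ∃ λ o → ∀ x →
              (x ∈ ⟦ o ⟧ → ∃ λ i → x ∈ ⟦ f i ⟧) × ((∃ λ i → x ∈ ⟦ f i ⟧) → x ∈ ⟦ o ⟧)

module _ {W : Set} (τ : Topology W) where
  open Topology τ

  IsOpen : Pred W 0ℓ → Set
  IsOpen U = ∃ λ o → (⟦ o ⟧ ⊆ U) × (U ⊆ ⟦ o ⟧)

  IsClosed : Pred W 0ℓ → Set
  IsClosed F = IsOpen (∁ F)

  closure : Pred W 0ℓ → Pred W 0ℓ
  closure S x = ∀ (o : O) → x ∈ ⟦ o ⟧ → ∃ λ y → y ∈ S × y ∈ ⟦ o ⟧

  IsCompact : Pred W 0ℓ → Set₁
  IsCompact A = ∀ (I : Set) (f : I → O) → A ⊆ (λ x → ∃ λ i → x ∈ ⟦ f i ⟧) →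
                ∃ λ (is : List I) → A ⊆ (λ x → Any (λ i → x ∈ ⟦ f i ⟧) is)

record GoodPartition {W : Set} (τ : Topology W) (P : Set) (_≤_ : Rel P 0ℓ) : Set₁ where
  field
    X        : P → Pred W 0ℓ
    nonempty : ∀ p → ∃ λ x → x ∈ X p
    disjoint : ∀ p q → ¬ (p ≡ q) → ∀ x → x ∈ X p → x ∈ X q → ⊥
    covers   : ∀ x → ∃ λ p → x ∈ X p
    closure⊆ : ∀ p → closure τ (X p) ⊆ (λ x → ∃ λ q → q ≤ p × x ∈ X q)
    ⊆closure : ∀ p → (λ x → ∃ λ q → q ≤ p × x ∈ X q) ⊆ closure τ (X p)

  T : Pred W 0ℓ → Pred P 0ℓ
  T Y p = ∃ λ x → x ∈ Y × x ∈ X p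

{-# OPTIONS --safe #-}
-- The closures of the X (c n) form a decreasing sequence of closed sets, each
-- meeting A, so by compactness some point x of A lies in all of them.
module Submission where

open import Defs
open import Level using (0ℓ)
open import Axiom.ExcludedMiddle using (ExcludedMiddle)
open import Axiom.DoubleNegationElimination using (DoubleNegationElimination; em⇒dne)
open import Data.Nat using (ℕ; suc; _≤′_; ≤′-reflexive; ≤′-step) renaming (_≤_ to _≤ℕ_)
open import Data.Nat.Properties using (≤⇒≤′)
open import Data.Product using (Σ; ∃; _×_; _,_; proj₁)
open import Data.List using (map)
open import Data.List.Extrema.Nat using (max; xs≤max)
import Data.List.Relation.Unary.Any as Any
import Data.List.Relation.Unary.All as All
import Data.List.Relation.Unary.All.Properties as All
open import Relation.Nullary using (¬_)
open import Function using (_∘_)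
open import Relation.Binary.Core using (Rel)
open import Relation.Binary.Structures using (IsPreorder; IsPartialOrder)
open import Relation.Binary.PropositionalEquality using (_≡_; refl; subst)
open import Relation.Unary using (Pred; _∈_; _⊆_)

module _ {P : Set} {_≤_ : Rel P 0ℓ} (≤-isPreorder : IsPreorder _≡_ _≤_)
         {c : ℕ → P} (descending : ∀ n → c (suc n) ≤ c n) where
  open IsPreorder ≤-isPreorder using () renaming (refl to ≤-refl; trans to ≤-trans)

  descending⇒antitone : ∀ {m n} → m ≤ℕ n → c n ≤ c m
  descending⇒antitone m≤n = go (≤⇒≤′ m≤n)
    where
    go : ∀ {m n} → m ≤′ n → c n ≤ c m
    go (≤′-reflexive refl) = ≤-refl
    go (≤′-step m≤′n)      = ≤-trans (descending _) (go m≤′n)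

module _ {W : Set} (τ : Topology W) (dne : DoubleNegationElimination 0ℓ) where
  open Topology τ

  ∉closure⇒avoiding-nbhd : ∀ {S : Pred W 0ℓ} {x} → ¬ x ∈ closure τ S →
                           ∃ λ o → x ∈ ⟦ o ⟧ × (∀ y → y ∈ ⟦ o ⟧ → ¬ y ∈ S)
  ∉closure⇒avoiding-nbhd x∉S̄ = dne λ no-nbhd → x∉S̄ λ o x∈o →
    dne λ o∩S=∅ → no-nbhd (o , x∈o , λ y y∈o y∈S → o∩S=∅ (y , y∈S , y∈o))

  compact-meets-⋂closure : ∀ {A : Pred W 0ℓ} → IsCompact τ A →
    (S : ℕ → Pred W 0ℓ) → (∀ {m n} → m ≤ℕ n → S n ⊆ closure τ (S m)) →
    (∀ n → ∃ λ x → x ∈ A × x ∈ S n) →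
    ∃ λ x → x ∈ A × ∀ n → x ∈ closure τ (S n)
  -- A finite subcover by open sets avoiding the S n only involves n ≤ N, and
  -- then a point of A ∩ S N ⊆ A ∩ closure (S n) cannot be covered.
  compact-meets-⋂closure {A} compact S S-antitone A∩S≠∅ = dne λ ⋂∩A=∅ →
    let (is , A⊆⋃is) = compact Avoiding nbhd (avoiding-cover ⋂∩A=∅)
        N            = max 0 (map proj₁ is)
        (x , x∈A , x∈S) = A∩S≠∅ N
        x∈⋃is        = A⊆⋃is x∈A
        (n , o , o∩S=∅) = Any.lookup x∈⋃is
        (n≤N , x∈o)  = All.lookupAny (All.map⁻ (xs≤max 0 (map proj₁ is))) x∈⋃is
        (y , y∈S , y∈o) = S-antitone n≤N x∈S o x∈o
    in o∩S=∅ y y∈o y∈S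
    where
    Avoiding : Set
    Avoiding = Σ ℕ λ n → Σ O λ o → ∀ y → y ∈ ⟦ o ⟧ → ¬ y ∈ S n

    nbhd : Avoiding → O
    nbhd (_ , o , _) = o

    avoiding-cover : ¬ (∃ λ x → x ∈ A × ∀ n → x ∈ closure τ (S n)) →
                     ∀ {x} → x ∈ A → ∃ λ (a : Avoiding) → x ∈ ⟦ nbhd a ⟧
    avoiding-cover ⋂∩A=∅ {x} x∈A = dne λ uncovered →
      ⋂∩A=∅ (x , x∈A , λ n → dne λ x∉S̄ →
        let (o , x∈o , o∩S=∅) = ∉closure⇒avoiding-nbhd x∉S̄
        in uncovered ((n , o , o∩S=∅) , x∈o))

module _ {W : Set} {τ : Topology W} {P : Set} {_≤_ : Rel P 0ℓ}
         (G : GoodPartition τ P _≤_) where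
  open GoodPartition G

  ∈closure⇒≤ : DoubleNegationElimination 0ℓ → ∀ {p q x} →
               x ∈ X q → x ∈ closure τ (X p) → q ≤ p
  ∈closure⇒≤ dne {q = q} {x} x∈Xq x∈X̄p with closure⊆ _ x∈X̄p
  ... | q′ , q′≤p , x∈Xq′ = subst (_≤ _) q′≡q q′≤p
    where
    q′≡q : q′ ≡ q
    q′≡q = dne λ q′≢q → disjoint q′ q q′≢q x x∈Xq′ x∈Xq

proposition2p9 : ExcludedMiddle 0ℓ →
    (P : Set) (_≤_ : Rel P 0ℓ) → IsPartialOrder _≡_ _≤_ →
    (W : Set) (τ : Topology W) (G : GoodPartition τ P _≤_) →
    (A : Pred W 0ℓ) → IsCompact τ A → IsClosed τ A →
    (c : ℕ → P) → (∀ n → c (suc n) ≤ c n) →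
    (∀ n → c n ∈ GoodPartition.T G A) →
    ∃ λ b → ∀ n → b ≤ c n
proposition2p9 em P _≤_ po W τ G A compact _ c descending c∈T =
  let (x , _ , x∈⋂) = compact-meets-⋂closure τ dne compact (X ∘ c) X∘c-antitone c∈T
      (q , x∈Xq)    = covers x
  in q , λ n → ∈closure⇒≤ G dne x∈Xq (x∈⋂ n)
  where
  open GoodPartition G

  dne : DoubleNegationElimination 0ℓ
  dne = em⇒dne em

  X∘c-antitone : ∀ {m n} → m ≤ℕ n → X (c n) ⊆ closure τ (X (c m))
  X∘c-antitone m≤n x∈X =
    ⊆closure _ (_ , descending⇒antitone (IsPartialOrder.isPreorder po) descending m≤n , x∈X)
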